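{- Let $\Pi$ be a polygraphic program, $\phi$ a compatible functorial interpretation of $\Pi$, and $\partial$ a compatible differential interpretation of $\Pi$ over $\phi$ into an ordered commutative monoid $(M,+,0,\preceq)$. Then for every $3$-path $F$, $\partial(s_2F)\succeq\partial(t_2F)$. If moreover $M$ is strictly ordered, $\partial$ is strictly compatible and $F$ is non-degenerate, then $\partial(s_2F)\succ\partial(t_2F)$. Finally, if $\partial$ is strictly compatible and $M$ is $\mathbb{N}$ with addition, then $|||F|||\le\partial(s_2F)(x)-\partial(t_2F)(x)$ for every $x\in\phi(s_1F)$, where $|||F|||$ is the number of $3$-cells in $F$.
   Context: A 3-polygraph freely generates a strict $3$-category whose $k$-morphisms are $k$-paths, composed by $\star_j$ ($0\le j<k$); $s_j,t_j$ are $j$-source/target; a $3$-path is degenerate if it contains no $3$-cell. A polygraphic program is a finite 3-polygraph with a single $0$-cell (with $2$-cells and $3$-cells classified into structure/constructor/function and structure/computation cells; this classification plays no role here). A functorial interpretation $\phi$ assigns to each $1$-path $u$ with $n$ $1$-cells a nonempty $\phi(u)\subseteq(\mathbb{N}\setminus\{0\})^n$ and to each $2$-path $f:u\Rightarrow v$ a monotone map $\phi(f):\phi(u)\to\phi(v)$ (product order), with $\phi(u\star_0v)=\phi(u)\times\phi(v)$, $\phi(f\star_0g)=\phi(f)\times\phi(g)$, $\phi(f\star_1g)=\phi(g)\circ\phi(f)$, identities to identities; it is compatible if $\phi(s_2\alpha)\ge\phi(t_2\alpha)$ for every $3$-cell $\alpha$. An ordered commutative monoid is an ordered set $(M,\preceq)$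 with a commutative monoid structure $(+,0)$ such that $+$ is monotone in both arguments; strictly ordered if $+$ is strictly monotone in both arguments. A differential interpretation $\partial$ over $\phi$ into $M$ assigns to each $2$-path $f$ with $1$-source $u$ a monotone map $\partial f:\phi(u)\to M$, with $\partial(\text{identity})=0$, $\partial(f\star_0g)(x,y)=\partial f(x)+\partial g(y)$, $\partial(f\star_1g)=\partial f+\partial g\circ\phi(f)$. It is (strictly) compatible if $\partial(s_2\alpha)\succeq\partial(t_2\alpha)$ (resp. $\succ$) pointwise for every $3$-cell $\alpha$. -}

module Defs where

open import Data.Nat as ℕ using (ℕ; zero; suc; _+_; _<_)
open import Data.Fin using (Fin)
open import Data.List using (List; []; _∷_; _++_; length; take; drop)
open import Data.List.Relation.Binary.Pointwise using (Pointwise)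
open import Data.Product using (∃; _×_)
open import Relation.Binary.PropositionalEquality using (_≡_; _≢_)
open import Relation.Binary.Structures using (IsPartialOrder)
open import Algebra.Structures using (IsCommutativeMonoid)

record OrderedCommutativeMonoid : Set₁ where
  infixl 6 _+ᴹ_
  infix 4 _≼_
  field
    Carrier : Set
    _≼_ : Carrier → Carrier → Set
    _+ᴹ_ : Carrier → Carrier → Carrier
    0ᴹ : Carrier
    isPartialOrder : IsPartialOrder _≡_ _≼_
    isCommutativeMonoid : IsCommutativeMonoid _≡_ _+ᴹ_ 0ᴹ
    +-mono : ∀ {x x′ y y′} → x ≼ x′ → y ≼ y′ → (x +ᴹ y) ≼ (x′ +ᴹ y′)

  _≺_ : Carrier → Carrier → Set
  x ≺ y = (x ≼ y) × (x ≢ y)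

StrictlyOrdered : OrderedCommutativeMonoid → Set
StrictlyOrdered M = ∀ {x x′ y} → (x ≺ x′ → (x +ᴹ y) ≺ (x′ +ᴹ y)) × (x ≺ x′ → (y +ᴹ x) ≺ (y +ᴹ x′))
  where open OrderedCommutativeMonoid M

ℕ-OCM : OrderedCommutativeMonoid
ℕ-OCM = record
  { Carrier = ℕ
  ; _≼_ = ℕ._≤_
  ; _+ᴹ_ = _+_
  ; 0ᴹ = 0
  ; isPartialOrder = Data.Nat.Properties.≤-isPartialOrder
  ; isCommutativeMonoid = Data.Nat.Properties.+-0-isCommutativeMonoid
  ; +-mono = Data.Nat.Properties.+-mono-≤
  }
  where import Data.Nat.Properties

-- 2-polygraphs with a single 0-cell (finitely many cells)

record 2-Polygraph : Set where
  field
    n₁ : ℕ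
    n₂ : ℕ
    src₂ tgt₂ : Fin n₂ → List (Fin n₁)
open 2-Polygraph public

-- 1-paths are words of 1-cells (free monoid), ⋆₀ is _++_.
1Path : 2-Polygraph → Set
1Path Σ = List (Fin (n₁ Σ))

-- raw terms for 2-paths of the free 2-category
module _ {Σ : 2-Polygraph} where

  infixl 7 _⋆₀_
  infixl 6 _⋆₁_
  data T2 : Set where
    cell : Fin (n₂ Σ) → T2
    idt  : 1Path Σ → T2
    _⋆₀_ : T2 → T2 → T2
    _⋆₁_ : T2 → T2 → T2

  s₁ t₁ : T2 → 1Path Σ
  s₁ (cell γ) = src₂ Σ γ
  s₁ (idt u) = u
  s₁ (f ⋆₀ g) = s₁ f ++ s₁ g
  s₁ (f ⋆₁ g) = s₁ f
  t₁ (cell γ) = tgt₂ Σ γ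
  t₁ (idt u) = u
  t₁ (f ⋆₀ g) = t₁ f ++ t₁ g
  t₁ (f ⋆₁ g) = t₁ g

  data WF2 : T2 → Set where
    wfcell : ∀ γ → WF2 (cell γ)
    wfidt : ∀ u → WF2 (idt u)
    wf⋆₀ : ∀ {f g} → WF2 f → WF2 g → WF2 (f ⋆₀ g)
    wf⋆₁ : ∀ {f g} → WF2 f → WF2 g → t₁ f ≡ s₁ g → WF2 (f ⋆₁ g)

  infix 4 _≈₂_
  data _≈₂_ : T2 → T2 → Set where
    ≈refl  : ∀ {f} → f ≈₂ f
    ≈sym   : ∀ {f g} → f ≈₂ g → g ≈₂ f
    ≈trans : ∀ {f g h} → f ≈₂ g → g ≈₂ h → f ≈₂ h
    ⋆₀-cong : ∀ {f f′ g g′} → f ≈₂ f′ → g ≈₂ g′ → f ⋆₀ g ≈₂ f′ ⋆₀ g′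
    ⋆₁-cong : ∀ {f f′ g g′} → f ≈₂ f′ → g ≈₂ g′ → f ⋆₁ g ≈₂ f′ ⋆₁ g′
    ⋆₀-assoc : ∀ {f g h} → (f ⋆₀ g) ⋆₀ h ≈₂ f ⋆₀ (g ⋆₀ h)
    ⋆₁-assoc : ∀ {f g h} → t₁ f ≡ s₁ g → t₁ g ≡ s₁ h → (f ⋆₁ g) ⋆₁ h ≈₂ f ⋆₁ (g ⋆₁ h)
    ⋆₀-unitˡ : ∀ {f} → idt [] ⋆₀ f ≈₂ f
    ⋆₀-unitʳ : ∀ {f} → f ⋆₀ idt [] ≈₂ f
    ⋆₁-unitˡ : ∀ {f} → idt (s₁ f) ⋆₁ f ≈₂ f
    ⋆₁-unitʳ : ∀ {f} → f ⋆₁ idt (t₁ f) ≈₂ f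
    idt-⋆₀ : ∀ {u v} → idt u ⋆₀ idt v ≈₂ idt (u ++ v)
    interchange : ∀ {f g f′ g′} → t₁ f ≡ s₁ g → t₁ f′ ≡ s₁ g′ →
                  (f ⋆₁ g) ⋆₀ (f′ ⋆₁ g′) ≈₂ (f ⋆₀ f′) ⋆₁ (g ⋆₀ g′)

-- Polygraphic programs (finite 3-polygraphs with a single 0-cell)

record PolygraphicProgram : Set where
  field
    Σ₂ : 2-Polygraph
    n₃ : ℕ
    src₃ tgt₃ : Fin n₃ → T2 {Σ₂}
    src₃-wf : ∀ α → WF2 (src₃ α)
    tgt₃-wf : ∀ α → WF2 (tgt₃ α)
    src₃-tgt₃-s₁ : ∀ α → s₁ (src₃ α) ≡ s₁ (tgt₃ α)
    src₃-tgt₃-t₁ : ∀ α → t₁ (src₃ α) ≡ t₁ (tgt₃ α)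
open PolygraphicProgram public

module _ {Π : PolygraphicProgram} where

  infixl 7 _⋆₀³_
  infixl 6 _⋆₁³_
  infixl 5 _⋆₂³_
  data T3 : Set where
    cell³ : Fin (n₃ Π) → T3
    idt³  : T2 {Σ₂ Π} → T3
    _⋆₀³_ _⋆₁³_ _⋆₂³_ : T3 → T3 → T3

  s₂ t₂ : T3 → T2 {Σ₂ Π}
  s₂ (cell³ α) = src₃ Π α
  s₂ (idt³ f) = f
  s₂ (F ⋆₀³ G) = s₂ F ⋆₀ s₂ G
  s₂ (F ⋆₁³ G) = s₂ F ⋆₁ s₂ G
  s₂ (F ⋆₂³ G) = s₂ F
  t₂ (cell³ α) = tgt₃ Π α
  t₂ (idt³ f) = f
  t₂ (F ⋆₀³ G) = t₂ F ⋆₀ t₂ G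
  t₂ (F ⋆₁³ G) = t₂ F ⋆₁ t₂ G
  t₂ (F ⋆₂³ G) = t₂ G

  -- well-formed terms = 3-paths
  data WF3 : T3 → Set where
    wfcell³ : ∀ α → WF3 (cell³ α)
    wfidt³ : ∀ {f} → WF2 f → WF3 (idt³ f)
    wf⋆₀³ : ∀ {F G} → WF3 F → WF3 G → WF3 (F ⋆₀³ G)
    wf⋆₁³ : ∀ {F G} → WF3 F → WF3 G → t₁ (s₂ F) ≡ s₁ (s₂ G) → WF3 (F ⋆₁³ G)
    wf⋆₂³ : ∀ {F G} → WF3 F → WF3 G → t₂ F ≈₂ s₂ G → WF3 (F ⋆₂³ G)

  #3cells : T3 → ℕ
  #3cells (cell³ α) = 1
  #3cells (idt³ f) = 0
  #3cells (F ⋆₀³ G) = #3cells F + #3cells G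
  #3cells (F ⋆₁³ G) = #3cells F + #3cells G
  #3cells (F ⋆₂³ G) = #3cells F + #3cells G

  Degenerate : T3 → Set
  Degenerate F = #3cells F ≡ 0

_≤*_ : List ℕ → List ℕ → Set
_≤*_ = Pointwise ℕ._≤_

-- φ on a 1-path u = a₁…aₙ is φ(a₁)×…×φ(aₙ); elements are lists of naturals
_∈φ[_]_ : List ℕ → ∀ {n} → (Fin n → ℕ → Set) → List (Fin n) → Set
xs ∈φ[ φ₁ ] u = Pointwise (λ x a → φ₁ a x) xs u

record FunctorialInterpretation (Σ : 2-Polygraph) : Set₁ where
  field
    φ₁ : Fin (n₁ Σ) → ℕ → Set
    φ₁-pos : ∀ a x → φ₁ a x → 0 < x
    φ₁-nonempty : ∀ a → ∃ (φ₁ a)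
    φ₂ : Fin (n₂ Σ) → List ℕ → List ℕ
    φ₂-maps : ∀ γ xs → xs ∈φ[ φ₁ ] src₂ Σ γ → φ₂ γ xs ∈φ[ φ₁ ] tgt₂ Σ γ
    φ₂-mono : ∀ γ xs ys → xs ∈φ[ φ₁ ] src₂ Σ γ → ys ∈φ[ φ₁ ] src₂ Σ γ →
              xs ≤* ys → φ₂ γ xs ≤* φ₂ γ ys

  _∈φ_ : List ℕ → 1Path Σ → Set
  xs ∈φ u = xs ∈φ[ φ₁ ] u

  φ : T2 {Σ} → List ℕ → List ℕ
  φ (cell γ) xs = φ₂ γ xs
  φ (idt u) xs = xs
  φ (f ⋆₀ g) xs = φ f (take (length (s₁ f)) xs) ++ φ g (drop (length (s₁ f)) xs)
  φ (f ⋆₁ g) xs = φ g (φ f xs)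

CompatibleFI : (Π : PolygraphicProgram) → FunctorialInterpretation (Σ₂ Π) → Set
CompatibleFI Π Φ = ∀ α xs → xs ∈φ s₁ (src₃ Π α) → φ (tgt₃ Π α) xs ≤* φ (src₃ Π α) xs
  where open FunctorialInterpretation Φ

record DifferentialInterpretation {Σ : 2-Polygraph} (Φ : FunctorialInterpretation Σ)
                                  (M : OrderedCommutativeMonoid) : Set where
  open FunctorialInterpretation Φ
  open OrderedCommutativeMonoid M
  field
    ∂₂ : Fin (n₂ Σ) → List ℕ → Carrier
    ∂₂-mono : ∀ γ xs ys → xs ∈φ src₂ Σ γ → ys ∈φ src₂ Σ γ →
              xs ≤* ys → ∂₂ γ xs ≼ ∂₂ γ ys

  ∂ : T2 {Σ} → List ℕ → Carrier
  ∂ (cell γ) xs = ∂₂ γ xs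
  ∂ (idt u) xs = 0ᴹ
  ∂ (f ⋆₀ g) xs = ∂ f (take (length (s₁ f)) xs) +ᴹ ∂ g (drop (length (s₁ f)) xs)
  ∂ (f ⋆₁ g) xs = ∂ f xs +ᴹ ∂ g (φ f xs)

module _ {Π : PolygraphicProgram} {Φ : FunctorialInterpretation (Σ₂ Π)}
         {M : OrderedCommutativeMonoid} where
  open FunctorialInterpretation Φ
  open OrderedCommutativeMonoid M
  open DifferentialInterpretation

  CompatibleDI : DifferentialInterpretation Φ M → Set
  CompatibleDI D = ∀ α xs → xs ∈φ s₁ (src₃ Π α) → ∂ D (tgt₃ Π α) xs ≼ ∂ D (src₃ Π α) xs

  StrictlyCompatibleDI : DifferentialInterpretation Φ M → Set
  StrictlyCompatibleDI D = ∀ α xs → xs ∈φ s₁ (src₃ Π α) → ∂ D (tgt₃ Π α) xs ≺ ∂ D (src₃ Π α) xs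

{-# OPTIONS --safe #-}
-- For ⋆₀ and ⋆₁ one adds up the inequalities for the
-- two factors; in the ⋆₁ case the second factor is evaluated at φ(t₂F)x on one side
-- and at φ(s₂F)x on the other, and these are bridged by φ(t₂F) ≤ φ(s₂F) (compatibility
-- of φ, by the same induction) and monotonicity of ∂.  For ⋆₂ one chains the two
-- inequalities, using that φ and ∂ respect the equations of the free 2-category.
-- The three statements are one induction, proved for any relation a ≼[ n ] b
-- ("b exceeds a by n 3-cells") closed under these steps, instantiated with a ≼ b,
-- with a ≼ b ∧ (n ≢ 0 → a ≺ b), and in ℕ with n + a ≤ b.

module Submission where

open import Defs
open import Data.Nat using (ℕ; zero; suc; _+_; _≤_; _∸_)
open import Data.Nat.Properties
  using ( suc-injective; ≤-refl; ≤-reflexive; ≤-trans; +-mono-≤; +-monoʳ-≤; +-assoc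
        ; ≤∧≢⇒<; m+n≤o⇒m≤o∸n; +-commutativeSemigroup)
open import Data.Product using (_×_; _,_; proj₁; proj₂; ∃₂; uncurry)
open import Data.Sum using (_⊎_; inj₁; inj₂; [_,_])
open import Data.Empty using (⊥-elim)
open import Data.List using (List; []; _∷_; _++_; length; take; drop)
open import Data.List.Properties using (++-assoc; ++-identityʳ; take++drop≡id)
open import Data.List.Relation.Binary.Pointwise using (Pointwise; []; _∷_; ++⁺)
open import Data.List.Relation.Binary.Pointwise.Properties
  using (Pointwise-length) renaming (refl to Pointwise-refl; transitive to Pointwise-trans)
open import Relation.Nullary using (¬_)
open import Relation.Binary.PropositionalEquality
  using (_≡_; _≢_; refl; sym; trans; cong; cong₂; subst; subst₂; module ≡-Reasoning)
open import Relation.Binary.Structures using (IsPartialOrder)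
open import Algebra.Bundles using (CommutativeSemigroup)
open import Algebra.Structures using (IsCommutativeMonoid)
import Algebra.Properties.CommutativeSemigroup as CommutativeSemigroupProperties
import Relation.Binary.Construct.NonStrictToStrict as NonStrictToStrict
open import Algebra.Properties.CommutativeSemigroup +-commutativeSemigroup
  using () renaming (interchange to +-interchange)

m+n≢0⇒m≢0⊎n≢0 : ∀ m {n} → m + n ≢ 0 → m ≢ 0 ⊎ n ≢ 0
m+n≢0⇒m≢0⊎n≢0 zero    n≢0 = inj₂ n≢0
m+n≢0⇒m≢0⊎n≢0 (suc m) _   = inj₁ λ ()

module _ {A B : Set} {R : A → B → Set} where

  Pointwise-++⁻ʳ : ∀ ys zs {xs} → Pointwise R xs (ys ++ zs) →
                   ∃₂ λ xs₁ xs₂ → xs ≡ xs₁ ++ xs₂ × Pointwise R xs₁ ys × Pointwise R xs₂ zs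
  Pointwise-++⁻ʳ []       zs {xs}     rs       = [] , xs , refl , [] , rs
  Pointwise-++⁻ʳ (y ∷ ys) zs {x ∷ xs} (r ∷ rs) with Pointwise-++⁻ʳ ys zs rs
  ... | xs₁ , xs₂ , refl , rs₁ , rs₂ = x ∷ xs₁ , xs₂ , refl , r ∷ rs₁ , rs₂

  Pointwise-++⁻ : ∀ {ws xs ys zs} → length ws ≡ length xs →
                  Pointwise R (ws ++ ys) (xs ++ zs) → Pointwise R ws xs × Pointwise R ys zs
  Pointwise-++⁻ {[]}     {[]}     _ rs       = [] , rs
  Pointwise-++⁻ {w ∷ ws} {x ∷ xs} e (r ∷ rs) with Pointwise-++⁻ {ws} {xs} (suc-injective e) rs
  ... | rs₁ , rs₂ = r ∷ rs₁ , rs₂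

module _ {A : Set} where

  take-length-++ : ∀ (xs ys : List A) {n} → length xs ≡ n → take n (xs ++ ys) ≡ xs
  take-length-++ []       ys refl = refl
  take-length-++ (x ∷ xs) ys refl = cong (x ∷_) (take-length-++ xs ys refl)

  drop-length-++ : ∀ (xs ys : List A) {n} → length xs ≡ n → drop n (xs ++ ys) ≡ ys
  drop-length-++ []       ys refl = refl
  drop-length-++ (x ∷ xs) ys refl = drop-length-++ xs ys refl

module _ {Σ : 2-Polygraph} where

  s₁-resp-≈₂ : ∀ {f g : T2 {Σ}} → f ≈₂ g → s₁ f ≡ s₁ g
  s₁-resp-≈₂ ≈refl                     = refl
  s₁-resp-≈₂ (≈sym p)                  = sym (s₁-resp-≈₂ p)
  s₁-resp-≈₂ (≈trans p q)              = trans (s₁-resp-≈₂ p) (s₁-resp-≈₂ q)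
  s₁-resp-≈₂ (⋆₀-cong p q)             = cong₂ _++_ (s₁-resp-≈₂ p) (s₁-resp-≈₂ q)
  s₁-resp-≈₂ (⋆₁-cong p _)             = s₁-resp-≈₂ p
  s₁-resp-≈₂ (⋆₀-assoc {f} {g} {h})    = ++-assoc (s₁ f) (s₁ g) (s₁ h)
  s₁-resp-≈₂ (⋆₁-assoc _ _)            = refl
  s₁-resp-≈₂ ⋆₀-unitˡ                  = refl
  s₁-resp-≈₂ (⋆₀-unitʳ {f})            = ++-identityʳ (s₁ f)
  s₁-resp-≈₂ ⋆₁-unitˡ                  = refl
  s₁-resp-≈₂ ⋆₁-unitʳ                  = refl
  s₁-resp-≈₂ idt-⋆₀                    = refl
  s₁-resp-≈₂ (interchange _ _)         = refl

  t₁-resp-≈₂ : ∀ {f g : T2 {Σ}} → f ≈₂ g → t₁ f ≡ t₁ g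
  t₁-resp-≈₂ ≈refl                     = refl
  t₁-resp-≈₂ (≈sym p)                  = sym (t₁-resp-≈₂ p)
  t₁-resp-≈₂ (≈trans p q)              = trans (t₁-resp-≈₂ p) (t₁-resp-≈₂ q)
  t₁-resp-≈₂ (⋆₀-cong p q)             = cong₂ _++_ (t₁-resp-≈₂ p) (t₁-resp-≈₂ q)
  t₁-resp-≈₂ (⋆₁-cong _ q)             = t₁-resp-≈₂ q
  t₁-resp-≈₂ (⋆₀-assoc {f} {g} {h})    = ++-assoc (t₁ f) (t₁ g) (t₁ h)
  t₁-resp-≈₂ (⋆₁-assoc _ _)            = refl
  t₁-resp-≈₂ ⋆₀-unitˡ                  = refl
  t₁-resp-≈₂ (⋆₀-unitʳ {f})            = ++-identityʳ (t₁ f)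
  t₁-resp-≈₂ ⋆₁-unitˡ                  = refl
  t₁-resp-≈₂ ⋆₁-unitʳ                  = refl
  t₁-resp-≈₂ idt-⋆₀                    = refl
  t₁-resp-≈₂ (interchange _ _)         = refl

  ≈₂-preserves-WF2 : ∀ {f g : T2 {Σ}} → f ≈₂ g → WF2 f → WF2 g
  ≈₂-reflects-WF2  : ∀ {f g : T2 {Σ}} → f ≈₂ g → WF2 g → WF2 f

  ≈₂-preserves-WF2 ≈refl w = w
  ≈₂-preserves-WF2 (≈sym p) w = ≈₂-reflects-WF2 p w
  ≈₂-preserves-WF2 (≈trans p q) w = ≈₂-preserves-WF2 q (≈₂-preserves-WF2 p w)
  ≈₂-preserves-WF2 (⋆₀-cong p q) (wf⋆₀ a b) = wf⋆₀ (≈₂-preserves-WF2 p a) (≈₂-preserves-WF2 q b)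
  ≈₂-preserves-WF2 (⋆₁-cong p q) (wf⋆₁ a b e) =
    wf⋆₁ (≈₂-preserves-WF2 p a) (≈₂-preserves-WF2 q b)
         (trans (sym (t₁-resp-≈₂ p)) (trans e (s₁-resp-≈₂ q)))
  ≈₂-preserves-WF2 ⋆₀-assoc (wf⋆₀ (wf⋆₀ a b) c) = wf⋆₀ a (wf⋆₀ b c)
  ≈₂-preserves-WF2 (⋆₁-assoc _ _) (wf⋆₁ (wf⋆₁ a b e₁) c e₂) = wf⋆₁ a (wf⋆₁ b c e₂) e₁
  ≈₂-preserves-WF2 ⋆₀-unitˡ (wf⋆₀ _ b) = b
  ≈₂-preserves-WF2 ⋆₀-unitʳ (wf⋆₀ a _) = a
  ≈₂-preserves-WF2 ⋆₁-unitˡ (wf⋆₁ _ b _) = b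
  ≈₂-preserves-WF2 ⋆₁-unitʳ (wf⋆₁ a _ _) = a
  ≈₂-preserves-WF2 idt-⋆₀ _ = wfidt _
  ≈₂-preserves-WF2 (interchange e e′) (wf⋆₀ (wf⋆₁ a b _) (wf⋆₁ a′ b′ _)) =
    wf⋆₁ (wf⋆₀ a a′) (wf⋆₀ b b′) (cong₂ _++_ e e′)

  ≈₂-reflects-WF2 ≈refl w = w
  ≈₂-reflects-WF2 (≈sym p) w = ≈₂-preserves-WF2 p w
  ≈₂-reflects-WF2 (≈trans p q) w = ≈₂-reflects-WF2 p (≈₂-reflects-WF2 q w)
  ≈₂-reflects-WF2 (⋆₀-cong p q) (wf⋆₀ a b) = wf⋆₀ (≈₂-reflects-WF2 p a) (≈₂-reflects-WF2 q b)
  ≈₂-reflects-WF2 (⋆₁-cong p q) (wf⋆₁ a b e) =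
    wf⋆₁ (≈₂-reflects-WF2 p a) (≈₂-reflects-WF2 q b)
         (trans (t₁-resp-≈₂ p) (trans e (sym (s₁-resp-≈₂ q))))
  ≈₂-reflects-WF2 ⋆₀-assoc (wf⋆₀ a (wf⋆₀ b c)) = wf⋆₀ (wf⋆₀ a b) c
  ≈₂-reflects-WF2 (⋆₁-assoc e₁ e₂) (wf⋆₁ a (wf⋆₁ b c _) _) = wf⋆₁ (wf⋆₁ a b e₁) c e₂
  ≈₂-reflects-WF2 ⋆₀-unitˡ b = wf⋆₀ (wfidt []) b
  ≈₂-reflects-WF2 ⋆₀-unitʳ a = wf⋆₀ a (wfidt [])
  ≈₂-reflects-WF2 ⋆₁-unitˡ b = wf⋆₁ (wfidt _) b refl
  ≈₂-reflects-WF2 ⋆₁-unitʳ a = wf⋆₁ a (wfidt _) refl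
  ≈₂-reflects-WF2 idt-⋆₀ _ = wf⋆₀ (wfidt _) (wfidt _)
  ≈₂-reflects-WF2 (interchange e e′) (wf⋆₁ (wf⋆₀ a a′) (wf⋆₀ b b′) _) =
    wf⋆₀ (wf⋆₁ a b e) (wf⋆₁ a′ b′ e′)

module FunctorialInterpretationProperties {Σ : 2-Polygraph} (Φ : FunctorialInterpretation Σ) where
  open FunctorialInterpretation Φ

  ∈φ-resp-≡ : ∀ {xs u v} → u ≡ v → xs ∈φ u → xs ∈φ v
  ∈φ-resp-≡ {xs} = subst (xs ∈φ_)

  φ-⋆₀-++ : ∀ (f g : T2 {Σ}) {as bs} → length as ≡ length (s₁ f) →
            φ (f ⋆₀ g) (as ++ bs) ≡ φ f as ++ φ g bs
  φ-⋆₀-++ f g {as} {bs} e =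
    cong₂ _++_ (cong (φ f) (take-length-++ as bs e)) (cong (φ g) (drop-length-++ as bs e))

  φ-∈φ : ∀ {f : T2 {Σ}} → WF2 f → ∀ {xs} → xs ∈φ s₁ f → φ f xs ∈φ t₁ f
  φ-∈φ (wfcell γ) m = φ₂-maps γ _ m
  φ-∈φ (wfidt u) m = m
  φ-∈φ (wf⋆₀ {f} {g} a b) {xs} m with Pointwise-++⁻ʳ (s₁ f) (s₁ g) m
  ... | as , bs , refl , ma , mb =
    subst (_∈φ (t₁ f ++ t₁ g)) (sym (φ-⋆₀-++ f g (Pointwise-length ma))) (++⁺ (φ-∈φ a ma) (φ-∈φ b mb))
  φ-∈φ (wf⋆₁ a b e) m = φ-∈φ b (∈φ-resp-≡ e (φ-∈φ a m))

  φ-mono : ∀ {f : T2 {Σ}} → WF2 f → ∀ {xs ys} → xs ∈φ s₁ f → ys ∈φ s₁ f →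
           xs ≤* ys → φ f xs ≤* φ f ys
  φ-mono (wfcell γ) mx my le = φ₂-mono γ _ _ mx my le
  φ-mono (wfidt u) _ _ le = le
  φ-mono (wf⋆₀ {f} {g} a b) mx my le
    with Pointwise-++⁻ʳ (s₁ f) (s₁ g) mx | Pointwise-++⁻ʳ (s₁ f) (s₁ g) my
  ... | as , bs , refl , ma , mb | cs , ds , refl , mc , md
    with Pointwise-++⁻ (trans (Pointwise-length ma) (sym (Pointwise-length mc))) le
  ... | le₁ , le₂ =
    subst₂ _≤*_ (sym (φ-⋆₀-++ f g (Pointwise-length ma))) (sym (φ-⋆₀-++ f g (Pointwise-length mc)))
      (++⁺ (φ-mono a ma mc le₁) (φ-mono b mb md le₂))
  φ-mono (wf⋆₁ a b e) mx my le =
    φ-mono b (∈φ-resp-≡ e (φ-∈φ a mx)) (∈φ-resp-≡ e (φ-∈φ a my)) (φ-mono a mx my le)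

  φ-resp-≈₂ : ∀ {f g : T2 {Σ}} → f ≈₂ g → WF2 f → ∀ {xs} → xs ∈φ s₁ f → φ f xs ≡ φ g xs
  φ-resp-≈₂ ≈refl _ _ = refl
  φ-resp-≈₂ (≈sym p) w m = sym (φ-resp-≈₂ p (≈₂-reflects-WF2 p w) (∈φ-resp-≡ (sym (s₁-resp-≈₂ p)) m))
  φ-resp-≈₂ (≈trans p q) w m =
    trans (φ-resp-≈₂ p w m) (φ-resp-≈₂ q (≈₂-preserves-WF2 p w) (∈φ-resp-≡ (s₁-resp-≈₂ p) m))
  φ-resp-≈₂ (⋆₀-cong {f} {f′} {g} {g′} p q) (wf⋆₀ a b) m with Pointwise-++⁻ʳ (s₁ f) (s₁ g) m
  ... | as , bs , refl , ma , mb = begin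
    φ (f ⋆₀ g) (as ++ bs)    ≡⟨ φ-⋆₀-++ f g (Pointwise-length ma) ⟩
    φ f as ++ φ g bs         ≡⟨ cong₂ _++_ (φ-resp-≈₂ p a ma) (φ-resp-≈₂ q b mb) ⟩
    φ f′ as ++ φ g′ bs       ≡⟨ φ-⋆₀-++ f′ g′ (trans (Pointwise-length ma) (cong length (s₁-resp-≈₂ p))) ⟨
    φ (f′ ⋆₀ g′) (as ++ bs)  ∎
    where open ≡-Reasoning
  φ-resp-≈₂ (⋆₁-cong {f} {f′} {g} {g′} p q) (wf⋆₁ a b e) m =
    trans (φ-resp-≈₂ q b (∈φ-resp-≡ e (φ-∈φ a m))) (cong (φ g′) (φ-resp-≈₂ p a m))
  φ-resp-≈₂ (⋆₀-assoc {f} {g} {h}) _ m with Pointwise-++⁻ʳ (s₁ f ++ s₁ g) (s₁ h) m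
  ... | abs , cs , refl , mab , mc with Pointwise-++⁻ʳ (s₁ f) (s₁ g) mab
  ... | as , bs , refl , ma , mb = begin
    φ ((f ⋆₀ g) ⋆₀ h) ((as ++ bs) ++ cs)  ≡⟨ φ-⋆₀-++ (f ⋆₀ g) h (Pointwise-length mab) ⟩
    φ (f ⋆₀ g) (as ++ bs) ++ φ h cs       ≡⟨ cong (_++ φ h cs) (φ-⋆₀-++ f g (Pointwise-length ma)) ⟩
    (φ f as ++ φ g bs) ++ φ h cs          ≡⟨ ++-assoc (φ f as) (φ g bs) (φ h cs) ⟩
    φ f as ++ (φ g bs ++ φ h cs)          ≡⟨ cong (φ f as ++_) (φ-⋆₀-++ g h (Pointwise-length mb)) ⟨
    φ f as ++ φ (g ⋆₀ h) (bs ++ cs)       ≡⟨ φ-⋆₀-++ f (g ⋆₀ h) (Pointwise-length ma) ⟨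
    φ (f ⋆₀ (g ⋆₀ h)) (as ++ (bs ++ cs))  ≡⟨ cong (φ (f ⋆₀ (g ⋆₀ h))) (++-assoc as bs cs) ⟨
    φ (f ⋆₀ (g ⋆₀ h)) ((as ++ bs) ++ cs)  ∎
    where open ≡-Reasoning
  φ-resp-≈₂ (⋆₁-assoc _ _) _ _ = refl
  φ-resp-≈₂ ⋆₀-unitˡ _ _ = refl
  φ-resp-≈₂ (⋆₀-unitʳ {f}) _ m with Pointwise-++⁻ʳ (s₁ f) [] m
  ... | as , [] , refl , ma , [] = begin
    φ (f ⋆₀ idt []) (as ++ [])  ≡⟨ φ-⋆₀-++ f (idt []) (Pointwise-length ma) ⟩
    φ f as ++ []                ≡⟨ ++-identityʳ (φ f as) ⟩
    φ f as                      ≡⟨ cong (φ f) (++-identityʳ as) ⟨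
    φ f (as ++ [])              ∎
    where open ≡-Reasoning
  φ-resp-≈₂ ⋆₁-unitˡ _ _ = refl
  φ-resp-≈₂ ⋆₁-unitʳ _ _ = refl
  φ-resp-≈₂ (idt-⋆₀ {u}) _ {xs} _ = take++drop≡id (length u) xs
  φ-resp-≈₂ (interchange {f} {g} {f′} {g′} e _) (wf⋆₀ (wf⋆₁ a _ _) _) m
    with Pointwise-++⁻ʳ (s₁ f) (s₁ f′) m
  ... | as , bs , refl , ma , _ = begin
    φ ((f ⋆₁ g) ⋆₀ (f′ ⋆₁ g′)) (as ++ bs)  ≡⟨ φ-⋆₀-++ (f ⋆₁ g) (f′ ⋆₁ g′) (Pointwise-length ma) ⟩
    φ g (φ f as) ++ φ g′ (φ f′ bs)         ≡⟨ φ-⋆₀-++ g g′ (trans (Pointwise-length (φ-∈φ a ma)) (cong length e)) ⟨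
    φ (g ⋆₀ g′) (φ f as ++ φ f′ bs)        ≡⟨ cong (φ (g ⋆₀ g′)) (φ-⋆₀-++ f f′ (Pointwise-length ma)) ⟨
    φ (g ⋆₀ g′) (φ (f ⋆₀ f′) (as ++ bs))   ∎
    where open ≡-Reasoning

module DifferentialInterpretationProperties
  {Σ : 2-Polygraph} {Φ : FunctorialInterpretation Σ} {M : OrderedCommutativeMonoid}
  (D : DifferentialInterpretation Φ M) where
  open FunctorialInterpretation Φ
  open FunctorialInterpretationProperties Φ
  open OrderedCommutativeMonoid M
  open DifferentialInterpretation D
  open IsPartialOrder isPartialOrder using () renaming (refl to ≼-refl)
  open IsCommutativeMonoid isCommutativeMonoid using (assoc; identityˡ; identityʳ; isCommutativeSemigroup)

  +ᴹ-commutativeSemigroup : CommutativeSemigroup _ _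
  +ᴹ-commutativeSemigroup = record { isCommutativeSemigroup = isCommutativeSemigroup }

  open CommutativeSemigroupProperties +ᴹ-commutativeSemigroup using () renaming (interchange to +ᴹ-interchange)

  ∂-⋆₀-++ : ∀ (f g : T2 {Σ}) {as bs} → length as ≡ length (s₁ f) →
            ∂ (f ⋆₀ g) (as ++ bs) ≡ ∂ f as +ᴹ ∂ g bs
  ∂-⋆₀-++ f g {as} {bs} e =
    cong₂ _+ᴹ_ (cong (∂ f) (take-length-++ as bs e)) (cong (∂ g) (drop-length-++ as bs e))

  ∂-mono : ∀ {f : T2 {Σ}} → WF2 f → ∀ {xs ys} → xs ∈φ s₁ f → ys ∈φ s₁ f →
           xs ≤* ys → ∂ f xs ≼ ∂ f ys
  ∂-mono (wfcell γ) mx my le = ∂₂-mono γ _ _ mx my le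
  ∂-mono (wfidt u) _ _ _ = ≼-refl
  ∂-mono (wf⋆₀ {f} {g} a b) mx my le
    with Pointwise-++⁻ʳ (s₁ f) (s₁ g) mx | Pointwise-++⁻ʳ (s₁ f) (s₁ g) my
  ... | as , bs , refl , ma , mb | cs , ds , refl , mc , md
    with Pointwise-++⁻ (trans (Pointwise-length ma) (sym (Pointwise-length mc))) le
  ... | le₁ , le₂ =
    subst₂ _≼_ (sym (∂-⋆₀-++ f g (Pointwise-length ma))) (sym (∂-⋆₀-++ f g (Pointwise-length mc)))
      (+-mono (∂-mono a ma mc le₁) (∂-mono b mb md le₂))
  ∂-mono (wf⋆₁ a b e) mx my le =
    +-mono (∂-mono a mx my le)
           (∂-mono b (∈φ-resp-≡ e (φ-∈φ a mx)) (∈φ-resp-≡ e (φ-∈φ a my)) (φ-mono a mx my le))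

  ∂-resp-≈₂ : ∀ {f g : T2 {Σ}} → f ≈₂ g → WF2 f → ∀ {xs} → xs ∈φ s₁ f → ∂ f xs ≡ ∂ g xs
  ∂-resp-≈₂ ≈refl _ _ = refl
  ∂-resp-≈₂ (≈sym p) w m = sym (∂-resp-≈₂ p (≈₂-reflects-WF2 p w) (∈φ-resp-≡ (sym (s₁-resp-≈₂ p)) m))
  ∂-resp-≈₂ (≈trans p q) w m =
    trans (∂-resp-≈₂ p w m) (∂-resp-≈₂ q (≈₂-preserves-WF2 p w) (∈φ-resp-≡ (s₁-resp-≈₂ p) m))
  ∂-resp-≈₂ (⋆₀-cong {f} {f′} {g} {g′} p q) (wf⋆₀ a b) m with Pointwise-++⁻ʳ (s₁ f) (s₁ g) m
  ... | as , bs , refl , ma , mb = begin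
    ∂ (f ⋆₀ g) (as ++ bs)    ≡⟨ ∂-⋆₀-++ f g (Pointwise-length ma) ⟩
    ∂ f as +ᴹ ∂ g bs         ≡⟨ cong₂ _+ᴹ_ (∂-resp-≈₂ p a ma) (∂-resp-≈₂ q b mb) ⟩
    ∂ f′ as +ᴹ ∂ g′ bs       ≡⟨ ∂-⋆₀-++ f′ g′ (trans (Pointwise-length ma) (cong length (s₁-resp-≈₂ p))) ⟨
    ∂ (f′ ⋆₀ g′) (as ++ bs)  ∎
    where open ≡-Reasoning
  ∂-resp-≈₂ (⋆₁-cong {f} {f′} {g} {g′} p q) (wf⋆₁ a b e) m =
    cong₂ _+ᴹ_ (∂-resp-≈₂ p a m)
               (trans (∂-resp-≈₂ q b (∈φ-resp-≡ e (φ-∈φ a m))) (cong (∂ g′) (φ-resp-≈₂ p a m)))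
  ∂-resp-≈₂ (⋆₀-assoc {f} {g} {h}) _ m with Pointwise-++⁻ʳ (s₁ f ++ s₁ g) (s₁ h) m
  ... | abs , cs , refl , mab , mc with Pointwise-++⁻ʳ (s₁ f) (s₁ g) mab
  ... | as , bs , refl , ma , mb = begin
    ∂ ((f ⋆₀ g) ⋆₀ h) ((as ++ bs) ++ cs)  ≡⟨ ∂-⋆₀-++ (f ⋆₀ g) h (Pointwise-length mab) ⟩
    ∂ (f ⋆₀ g) (as ++ bs) +ᴹ ∂ h cs       ≡⟨ cong (_+ᴹ ∂ h cs) (∂-⋆₀-++ f g (Pointwise-length ma)) ⟩
    (∂ f as +ᴹ ∂ g bs) +ᴹ ∂ h cs          ≡⟨ assoc (∂ f as) (∂ g bs) (∂ h cs) ⟩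
    ∂ f as +ᴹ (∂ g bs +ᴹ ∂ h cs)          ≡⟨ cong (∂ f as +ᴹ_) (∂-⋆₀-++ g h (Pointwise-length mb)) ⟨
    ∂ f as +ᴹ ∂ (g ⋆₀ h) (bs ++ cs)       ≡⟨ ∂-⋆₀-++ f (g ⋆₀ h) (Pointwise-length ma) ⟨
    ∂ (f ⋆₀ (g ⋆₀ h)) (as ++ (bs ++ cs))  ≡⟨ cong (∂ (f ⋆₀ (g ⋆₀ h))) (++-assoc as bs cs) ⟨
    ∂ (f ⋆₀ (g ⋆₀ h)) ((as ++ bs) ++ cs)  ∎
    where open ≡-Reasoning
  ∂-resp-≈₂ (⋆₁-assoc {f} {g} {h} _ _) _ {xs} _ = assoc (∂ f xs) (∂ g (φ f xs)) (∂ h (φ g (φ f xs)))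
  ∂-resp-≈₂ ⋆₀-unitˡ _ _ = identityˡ _
  ∂-resp-≈₂ (⋆₀-unitʳ {f}) _ m with Pointwise-++⁻ʳ (s₁ f) [] m
  ... | as , [] , refl , ma , [] = begin
    ∂ (f ⋆₀ idt []) (as ++ [])  ≡⟨ ∂-⋆₀-++ f (idt []) (Pointwise-length ma) ⟩
    ∂ f as +ᴹ 0ᴹ                ≡⟨ identityʳ (∂ f as) ⟩
    ∂ f as                      ≡⟨ cong (∂ f) (++-identityʳ as) ⟨
    ∂ f (as ++ [])              ∎
    where open ≡-Reasoning
  ∂-resp-≈₂ ⋆₁-unitˡ _ _ = identityˡ _
  ∂-resp-≈₂ ⋆₁-unitʳ _ _ = identityʳ _
  ∂-resp-≈₂ idt-⋆₀ _ _ = identityˡ 0ᴹ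
  ∂-resp-≈₂ (interchange {f} {g} {f′} {g′} e _) (wf⋆₀ (wf⋆₁ a _ _) _) m
    with Pointwise-++⁻ʳ (s₁ f) (s₁ f′) m
  ... | as , bs , refl , ma , _ = begin
    ∂ ((f ⋆₁ g) ⋆₀ (f′ ⋆₁ g′)) (as ++ bs)
      ≡⟨ ∂-⋆₀-++ (f ⋆₁ g) (f′ ⋆₁ g′) (Pointwise-length ma) ⟩
    (∂ f as +ᴹ ∂ g (φ f as)) +ᴹ (∂ f′ bs +ᴹ ∂ g′ (φ f′ bs))
      ≡⟨ +ᴹ-interchange (∂ f as) (∂ g (φ f as)) (∂ f′ bs) (∂ g′ (φ f′ bs)) ⟩
    (∂ f as +ᴹ ∂ f′ bs) +ᴹ (∂ g (φ f as) +ᴹ ∂ g′ (φ f′ bs))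
      ≡⟨ cong₂ _+ᴹ_ (∂-⋆₀-++ f f′ (Pointwise-length ma))
                    (∂-⋆₀-++ g g′ (trans (Pointwise-length (φ-∈φ a ma)) (cong length e))) ⟨
    ∂ (f ⋆₀ f′) (as ++ bs) +ᴹ ∂ (g ⋆₀ g′) (φ f as ++ φ f′ bs)
      ≡⟨ cong (λ ys → ∂ (f ⋆₀ f′) (as ++ bs) +ᴹ ∂ (g ⋆₀ g′) ys) (φ-⋆₀-++ f f′ (Pointwise-length ma)) ⟨
    ∂ ((f ⋆₀ f′) ⋆₁ (g ⋆₀ g′)) (as ++ bs)
      ∎
    where open ≡-Reasoning

module _ {Π : PolygraphicProgram} where

  s₁-s₂≡s₁-t₂ : ∀ {F : T3 {Π}} → WF3 F → s₁ (s₂ F) ≡ s₁ (t₂ F)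
  s₁-s₂≡s₁-t₂ (wfcell³ α)    = src₃-tgt₃-s₁ Π α
  s₁-s₂≡s₁-t₂ (wfidt³ _)     = refl
  s₁-s₂≡s₁-t₂ (wf⋆₀³ a b)    = cong₂ _++_ (s₁-s₂≡s₁-t₂ a) (s₁-s₂≡s₁-t₂ b)
  s₁-s₂≡s₁-t₂ (wf⋆₁³ a _ _)  = s₁-s₂≡s₁-t₂ a
  s₁-s₂≡s₁-t₂ (wf⋆₂³ a b e)  = trans (s₁-s₂≡s₁-t₂ a) (trans (s₁-resp-≈₂ e) (s₁-s₂≡s₁-t₂ b))

  t₁-s₂≡t₁-t₂ : ∀ {F : T3 {Π}} → WF3 F → t₁ (s₂ F) ≡ t₁ (t₂ F)
  t₁-s₂≡t₁-t₂ (wfcell³ α)    = src₃-tgt₃-t₁ Π α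
  t₁-s₂≡t₁-t₂ (wfidt³ _)     = refl
  t₁-s₂≡t₁-t₂ (wf⋆₀³ a b)    = cong₂ _++_ (t₁-s₂≡t₁-t₂ a) (t₁-s₂≡t₁-t₂ b)
  t₁-s₂≡t₁-t₂ (wf⋆₁³ _ b _)  = t₁-s₂≡t₁-t₂ b
  t₁-s₂≡t₁-t₂ (wf⋆₂³ a b e)  = trans (t₁-s₂≡t₁-t₂ a) (trans (t₁-resp-≈₂ e) (t₁-s₂≡t₁-t₂ b))

  WF2-s₂ : ∀ {F : T3 {Π}} → WF3 F → WF2 (s₂ F)
  WF2-s₂ (wfcell³ α)    = src₃-wf Π α
  WF2-s₂ (wfidt³ w)     = w
  WF2-s₂ (wf⋆₀³ a b)    = wf⋆₀ (WF2-s₂ a) (WF2-s₂ b)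
  WF2-s₂ (wf⋆₁³ a b e)  = wf⋆₁ (WF2-s₂ a) (WF2-s₂ b) e
  WF2-s₂ (wf⋆₂³ a _ _)  = WF2-s₂ a

  WF2-t₂ : ∀ {F : T3 {Π}} → WF3 F → WF2 (t₂ F)
  WF2-t₂ (wfcell³ α)    = tgt₃-wf Π α
  WF2-t₂ (wfidt³ w)     = w
  WF2-t₂ (wf⋆₀³ a b)    = wf⋆₀ (WF2-t₂ a) (WF2-t₂ b)
  WF2-t₂ (wf⋆₁³ a b e)  = wf⋆₁ (WF2-t₂ a) (WF2-t₂ b) (trans (sym (t₁-s₂≡t₁-t₂ a)) (trans e (s₁-s₂≡s₁-t₂ b)))
  WF2-t₂ (wf⋆₂³ _ b _)  = WF2-t₂ b

record GradedOrder (M : OrderedCommutativeMonoid) : Set₁ where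
  open OrderedCommutativeMonoid M
  infix 4 _≼[_]_
  field
    _≼[_]_       : Carrier → ℕ → Carrier → Set
    ≼[0]-refl    : ∀ {a} → a ≼[ 0 ] a
    +-mono-≼[]   : ∀ {a b c d m n} → a ≼[ m ] b → c ≼[ n ] d → a +ᴹ c ≼[ m + n ] b +ᴹ d
    ≼-≼[]-trans  : ∀ {a b c n} → a ≼ b → b ≼[ n ] c → a ≼[ n ] c
    ≼[]-trans    : ∀ {a b c m n} → b ≼[ m ] c → a ≼[ n ] b → a ≼[ m + n ] c

module _ (M : OrderedCommutativeMonoid) where
  open OrderedCommutativeMonoid M
  open IsPartialOrder isPartialOrder
    using (antisym; ≤-respˡ-≈; ≤-respʳ-≈) renaming (refl to ≼-refl; trans to ≼-trans)

  ≼-graded : GradedOrder M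
  ≼-graded = record
    { _≼[_]_      = λ a _ b → a ≼ b
    ; ≼[0]-refl   = ≼-refl
    ; +-mono-≼[]  = +-mono
    ; ≼-≼[]-trans = ≼-trans
    ; ≼[]-trans   = λ b≼c a≼b → ≼-trans a≼b b≼c
    }

  module _ (strictly : StrictlyOrdered M) where
    open NonStrictToStrict _≡_ _≼_ using (<-≤-trans; ≤-<-trans)

    infix 4 _≼⁺[_]_
    _≼⁺[_]_ : Carrier → ℕ → Carrier → Set
    a ≼⁺[ n ] b = a ≼ b × (n ≢ 0 → a ≺ b)

    ≺⇒≼⁺ : ∀ {a b n} → a ≺ b → a ≼⁺[ n ] b
    ≺⇒≼⁺ a≺b = proj₁ a≺b , λ _ → a≺b

    ≺-≼-trans : ∀ {a b c} → a ≺ b → b ≼ c → a ≺ c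
    ≺-≼-trans = <-≤-trans sym ≼-trans antisym ≤-respʳ-≈

    ≼-≺-trans : ∀ {a b c} → a ≼ b → b ≺ c → a ≺ c
    ≼-≺-trans = ≤-<-trans ≼-trans antisym ≤-respˡ-≈

    +-mono-≼⁺ : ∀ {a b c d m n} → a ≼⁺[ m ] b → c ≼⁺[ n ] d → a +ᴹ c ≼⁺[ m + n ] b +ᴹ d
    +-mono-≼⁺ {m = m} (a≼b , a≺b) (c≼d , c≺d) =
      +-mono a≼b c≼d ,
      λ m+n≢0 → [ (λ m≢0 → ≺-≼-trans (proj₁ strictly (a≺b m≢0)) (+-mono ≼-refl c≼d))
                , (λ n≢0 → ≼-≺-trans (+-mono a≼b ≼-refl) (proj₂ strictly (c≺d n≢0)))
                ] (m+n≢0⇒m≢0⊎n≢0 m m+n≢0)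

    ≼-≼⁺-trans : ∀ {a b c n} → a ≼ b → b ≼⁺[ n ] c → a ≼⁺[ n ] c
    ≼-≼⁺-trans a≼b (b≼c , b≺c) = ≼-trans a≼b b≼c , λ n≢0 → ≼-≺-trans a≼b (b≺c n≢0)

    ≼⁺-trans : ∀ {a b c m n} → b ≼⁺[ m ] c → a ≼⁺[ n ] b → a ≼⁺[ m + n ] c
    ≼⁺-trans {m = m} (b≼c , b≺c) (a≼b , a≺b) =
      ≼-trans a≼b b≼c ,
      λ m+n≢0 → [ (λ m≢0 → ≼-≺-trans a≼b (b≺c m≢0))
                , (λ n≢0 → ≺-≼-trans (a≺b n≢0) b≼c)
                ] (m+n≢0⇒m≢0⊎n≢0 m m+n≢0)

    ≺-graded : GradedOrder M
    ≺-graded = record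
      { _≼[_]_      = _≼⁺[_]_
      ; ≼[0]-refl   = ≼-refl , λ 0≢0 → ⊥-elim (0≢0 refl)
      ; +-mono-≼[]  = +-mono-≼⁺
      ; ≼-≼[]-trans = ≼-≼⁺-trans
      ; ≼[]-trans   = ≼⁺-trans
      }

ℕ-graded : GradedOrder ℕ-OCM
ℕ-graded = record
  { _≼[_]_      = λ a n b → n + a ≤ b
  ; ≼[0]-refl   = ≤-refl
  ; +-mono-≼[]  = λ {a} {b} {c} {d} {m} {n} m+a≤b n+c≤d →
                    ≤-trans (≤-reflexive (+-interchange m n a c)) (+-mono-≤ m+a≤b n+c≤d)
  ; ≼-≼[]-trans = λ {n = n} a≤b n+b≤c → ≤-trans (+-monoʳ-≤ n a≤b) n+b≤c
  ; ≼[]-trans   = λ {a} {m = m} {n} m+b≤c n+a≤b →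
                    ≤-trans (≤-reflexive (+-assoc m n a)) (≤-trans (+-monoʳ-≤ m n+a≤b) m+b≤c)
  }

module InterpretationsOf3Paths (Π : PolygraphicProgram) (Φ : FunctorialInterpretation (Σ₂ Π))
                               (compatible : CompatibleFI Π Φ) where
  open FunctorialInterpretation Φ
  open FunctorialInterpretationProperties Φ

  ∈φ-s₁-t₂ : ∀ {F : T3 {Π}} → WF3 F → ∀ {xs} → xs ∈φ s₁ (s₂ F) → xs ∈φ s₁ (t₂ F)
  ∈φ-s₁-t₂ w = ∈φ-resp-≡ (s₁-s₂≡s₁-t₂ w)

  φ-t₂-∈φ-t₁-s₂ : ∀ {F : T3 {Π}} → WF3 F → ∀ {xs} → xs ∈φ s₁ (s₂ F) → φ (t₂ F) xs ∈φ t₁ (s₂ F)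
  φ-t₂-∈φ-t₁-s₂ w m = ∈φ-resp-≡ (sym (t₁-s₂≡t₁-t₂ w)) (φ-∈φ (WF2-t₂ w) (∈φ-s₁-t₂ w m))

  φ-t₂≤*φ-s₂ : ∀ {F : T3 {Π}} → WF3 F → ∀ {xs} → xs ∈φ s₁ (s₂ F) → φ (t₂ F) xs ≤* φ (s₂ F) xs
  φ-t₂≤*φ-s₂ (wfcell³ α) m = compatible α _ m
  φ-t₂≤*φ-s₂ (wfidt³ _) _ = Pointwise-refl ≤-refl
  φ-t₂≤*φ-s₂ (wf⋆₀³ {F} {G} a b) m with Pointwise-++⁻ʳ (s₁ (s₂ F)) (s₁ (s₂ G)) m
  ... | as , bs , refl , ma , mb =
    subst₂ _≤*_ (sym (φ-⋆₀-++ (t₂ F) (t₂ G) (trans (Pointwise-length ma) (cong length (s₁-s₂≡s₁-t₂ a)))))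
                (sym (φ-⋆₀-++ (s₂ F) (s₂ G) (Pointwise-length ma)))
                (++⁺ (φ-t₂≤*φ-s₂ a ma) (φ-t₂≤*φ-s₂ b mb))
  φ-t₂≤*φ-s₂ (wf⋆₁³ {F} {G} a b e) {xs} m =
    Pointwise-trans ≤-trans
      (φ-mono (WF2-t₂ b) (∈φ-s₁-t₂ b φt∈) (∈φ-s₁-t₂ b φs∈) (φ-t₂≤*φ-s₂ a m))
      (φ-t₂≤*φ-s₂ b φs∈)
    where
    φs∈ : φ (s₂ F) xs ∈φ s₁ (s₂ G)
    φs∈ = ∈φ-resp-≡ e (φ-∈φ (WF2-s₂ a) m)
    φt∈ : φ (t₂ F) xs ∈φ s₁ (s₂ G)
    φt∈ = ∈φ-resp-≡ e (φ-t₂-∈φ-t₁-s₂ a m)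
  φ-t₂≤*φ-s₂ (wf⋆₂³ {F} {G} a b e) {xs} m =
    Pointwise-trans ≤-trans
      (φ-t₂≤*φ-s₂ b (∈φ-resp-≡ (trans (s₁-s₂≡s₁-t₂ a) (s₁-resp-≈₂ e)) m))
      (subst (_≤* φ (s₂ F) xs) (φ-resp-≈₂ e (WF2-t₂ a) (∈φ-s₁-t₂ a m)) (φ-t₂≤*φ-s₂ a m))

  module _ {M : OrderedCommutativeMonoid} (D : DifferentialInterpretation Φ M) (grading : GradedOrder M) where
    open DifferentialInterpretation D
    open DifferentialInterpretationProperties D
    open GradedOrder grading

    ∂-t₂≼[#3cells]∂-s₂ :
      (∀ α xs → xs ∈φ s₁ (src₃ Π α) → ∂ (tgt₃ Π α) xs ≼[ 1 ] ∂ (src₃ Π α) xs) →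
      ∀ {F : T3 {Π}} → WF3 F → ∀ {xs} → xs ∈φ s₁ (s₂ F) → ∂ (t₂ F) xs ≼[ #3cells F ] ∂ (s₂ F) xs
    ∂-t₂≼[#3cells]∂-s₂ cells (wfcell³ α) m = cells α _ m
    ∂-t₂≼[#3cells]∂-s₂ cells (wfidt³ _) _ = ≼[0]-refl
    ∂-t₂≼[#3cells]∂-s₂ cells (wf⋆₀³ {F} {G} a b) m with Pointwise-++⁻ʳ (s₁ (s₂ F)) (s₁ (s₂ G)) m
    ... | as , bs , refl , ma , mb =
      subst₂ _≼[ #3cells F + #3cells G ]_
        (sym (∂-⋆₀-++ (t₂ F) (t₂ G) (trans (Pointwise-length ma) (cong length (s₁-s₂≡s₁-t₂ a)))))
        (sym (∂-⋆₀-++ (s₂ F) (s₂ G) (Pointwise-length ma)))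
        (+-mono-≼[] (∂-t₂≼[#3cells]∂-s₂ cells a ma) (∂-t₂≼[#3cells]∂-s₂ cells b mb))
    ∂-t₂≼[#3cells]∂-s₂ cells (wf⋆₁³ {F} {G} a b e) {xs} m =
      +-mono-≼[] (∂-t₂≼[#3cells]∂-s₂ cells a m)
        (≼-≼[]-trans (∂-mono (WF2-t₂ b) (∈φ-s₁-t₂ b φt∈) (∈φ-s₁-t₂ b φs∈) (φ-t₂≤*φ-s₂ a m))
                     (∂-t₂≼[#3cells]∂-s₂ cells b φs∈))
      where
      φs∈ : φ (s₂ F) xs ∈φ s₁ (s₂ G)
      φs∈ = ∈φ-resp-≡ e (φ-∈φ (WF2-s₂ a) m)
      φt∈ : φ (t₂ F) xs ∈φ s₁ (s₂ G)
      φt∈ = ∈φ-resp-≡ e (φ-t₂-∈φ-t₁-s₂ a m)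
    ∂-t₂≼[#3cells]∂-s₂ cells (wf⋆₂³ {F} {G} a b e) {xs} m =
      ≼[]-trans (∂-t₂≼[#3cells]∂-s₂ cells a m)
        (subst (∂ (t₂ G) xs ≼[ #3cells G ]_) (sym (∂-resp-≈₂ e (WF2-t₂ a) (∈φ-s₁-t₂ a m)))
          (∂-t₂≼[#3cells]∂-s₂ cells b (∈φ-resp-≡ (trans (s₁-s₂≡s₁-t₂ a) (s₁-resp-≈₂ e)) m)))

  open DifferentialInterpretation using (∂)

  ∂-t₂≼∂-s₂ : (M : OrderedCommutativeMonoid) (D : DifferentialInterpretation Φ M) →
              CompatibleDI {Π} D → ∀ {F : T3 {Π}} → WF3 F → ∀ {xs} → xs ∈φ s₁ (s₂ F) →
              OrderedCommutativeMonoid._≼_ M (∂ D (t₂ F) xs) (∂ D (s₂ F) xs)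
  ∂-t₂≼∂-s₂ M D compatibleD = ∂-t₂≼[#3cells]∂-s₂ D (≼-graded M) compatibleD

  ∂-t₂≺∂-s₂ : (M : OrderedCommutativeMonoid) (D : DifferentialInterpretation Φ M) →
              StrictlyOrdered M → StrictlyCompatibleDI {Π} D →
              ∀ {F : T3 {Π}} → WF3 F → ¬ Degenerate F → ∀ {xs} → xs ∈φ s₁ (s₂ F) →
              OrderedCommutativeMonoid._≺_ M (∂ D (t₂ F) xs) (∂ D (s₂ F) xs)
  ∂-t₂≺∂-s₂ M D strictly strictlyCompatible w nondegenerate m =
    proj₂ (∂-t₂≼[#3cells]∂-s₂ D (≺-graded M strictly)
             (λ α xs m → ≺⇒≼⁺ M strictly (strictlyCompatible α xs m)) w m)
          nondegenerate

  #3cells≤∂-s₂∸∂-t₂ : (D : DifferentialInterpretation Φ ℕ-OCM) → StrictlyCompatibleDI {Π} D →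
                      ∀ {F : T3 {Π}} → WF3 F → ∀ {xs} → xs ∈φ s₁ (s₂ F) →
                      #3cells F ≤ ∂ D (s₂ F) xs ∸ ∂ D (t₂ F) xs
  #3cells≤∂-s₂∸∂-t₂ D strictlyCompatible {F} w m =
    m+n≤o⇒m≤o∸n (#3cells F)
      (∂-t₂≼[#3cells]∂-s₂ D ℕ-graded (λ α xs m → uncurry ≤∧≢⇒< (strictlyCompatible α xs m)) w m)

proposition2p21 : (Π : PolygraphicProgram) (Φ : FunctorialInterpretation (Σ₂ Π)) →
    CompatibleFI Π Φ →
    -- (1) compatible ∂ into an ordered commutative monoid: ∂(s₂F) ≽ ∂(t₂F)
    ((M : OrderedCommutativeMonoid) (D : DifferentialInterpretation Φ M) →
      CompatibleDI {Π} D →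
      (F : T3 {Π}) → WF3 F →
      ∀ xs → FunctorialInterpretation._∈φ_ Φ xs (s₁ (s₂ F)) →
      OrderedCommutativeMonoid._≼_ M
        (DifferentialInterpretation.∂ D (t₂ F) xs)
        (DifferentialInterpretation.∂ D (s₂ F) xs))
    ×
    -- (2) strictly ordered M, strictly compatible ∂, non-degenerate F: ∂(s₂F) ≻ ∂(t₂F)
    ((M : OrderedCommutativeMonoid) (D : DifferentialInterpretation Φ M) →
      StrictlyOrdered M →
      StrictlyCompatibleDI {Π} D →
      (F : T3 {Π}) → WF3 F → ¬ Degenerate F →
      ∀ xs → FunctorialInterpretation._∈φ_ Φ xs (s₁ (s₂ F)) →
      OrderedCommutativeMonoid._≺_ M
        (DifferentialInterpretation.∂ D (t₂ F) xs)
        (DifferentialInterpretation.∂ D (s₂ F) xs))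
    ×
    -- (3) M = (ℕ, +), strictly compatible ∂: |||F||| ≤ ∂(s₂F)(x) − ∂(t₂F)(x)
    ((D : DifferentialInterpretation Φ ℕ-OCM) →
      StrictlyCompatibleDI {Π} D →
      (F : T3 {Π}) → WF3 F →
      ∀ xs → FunctorialInterpretation._∈φ_ Φ xs (s₁ (s₂ F)) →
      #3cells F ≤ DifferentialInterpretation.∂ D (s₂ F) xs ∸ DifferentialInterpretation.∂ D (t₂ F) xs)
proposition2p21 Π Φ compatible =
    (λ M D compatibleD F w xs → ∂-t₂≼∂-s₂ M D compatibleD w)
  , (λ M D strictly strictlyCompatible F w nondegenerate xs →
       ∂-t₂≺∂-s₂ M D strictly strictlyCompatible w nondegenerate)
  , (λ D strictlyCompatible F w xs → #3cells≤∂-s₂∸∂-t₂ D strictlyCompatible w)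
  where open InterpretationsOf3Paths Π Φ compatible
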